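{- Fix $\alpha\in(1/2,1)$ and let $U_n$ ($n\geq 0$) be the trees defined in the context. For every $n\geq 0$ and every rooted tree $T$ on $n$ nodes, $U_n$ contains a subgraph isomorphic to a subdivision of $T$ (i.e., $T$ is a topological minor of $U_n$).
   Context: Trees are finite and rooted, edges directed from parent to child, degrees unbounded. A rooted tree $T$ is a topological minor of a rooted tree $U$ if $U$ contains as a subgraph, respecting root and edge directions, a subdivision of $T$; equivalently there is an injective map $f$ from nodes of $T$ to nodes of $U$ with $f(\mathsf{NCA}_T(u,v))=\mathsf{NCA}_U(f(u),f(v))$. Sequences $a_N$ of positive integers: $a_0$ is the empty sequence, $a_1=(1)$, and for $N\geq 2$, $a_N=a_{\lfloor N/2\rfloor}\oplus(N)\oplus a_{\lfloor N/2\rfloor}$, where $\oplus$ is concatenation. "Attaching a copy of a tree $X$ to a node $u$" means adding a disjoint copy of $X$ and making its root a child of $u$ (attaching the empty tree does nothing). Define $U_0$ as the empty tree. For $n\geq 1$, let $a_{\lfloor(1-\alpha)n\rfloor}=(a(1),\dots,a(k))$; $U_n$ consists of a path $u_1-u_2-\dots-u_{k+1}$ rooted at $u_1$, where for each $i=1,\dots,k$ a copy of $U_{a(i)-1}$ and, for every integer $j\geq 2$, a copy of $U_{\lfloor a(i)/j\rfloor}$ are attached to $u_i$; additionally a copy of $U_{\lfloor\alpha n\rfloor}$ and, for every integer $j\geq 2$, a copy of $U_{\lfloor (n-1)/j\rfloor}$ are attached to $u_{k+1}$. -}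

module Defs where

open import Data.Nat using (ℕ; zero; suc; _+_; _∸_; _/_)
open import Data.Integer as ℤ using (ℤ; +_)
open import Data.Rational as ℚ using (ℚ; ½; 1ℚ)
open import Data.Fin as Fin using (Fin)
open import Data.List using (List; []; _∷_; _++_; length; lookup; map; concatMap; upTo; foldr; sum)
open import Data.Maybe using (Maybe; just; nothing)
open import Data.Product using (Σ; ∃; _×_; _,_)
open import Data.Sum using (_⊎_)
open import Data.Empty using (⊥)
open import Relation.Nullary using (¬_; yes; no)
open import Relation.Binary.PropositionalEquality using (_≡_; refl)
open import Function.Definitions using (Injective)

-- Real numbers as Dedekind cuts over ℚ (stdlib has no reals).
-- L q means q < α, U q means α < q.

record Real : Set₁ where
  field
    L U      : ℚ → Set
    L-inh    : ∃ λ q → L q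
    U-inh    : ∃ λ q → U q
    L-down   : ∀ {p q} → p ℚ.< q → L q → L p
    L-open   : ∀ {q} → L q → ∃ λ r → q ℚ.< r × L r
    U-up     : ∀ {p q} → p ℚ.< q → U p → U q
    U-open   : ∀ {q} → U q → ∃ λ r → r ℚ.< q × U r
    disjoint : ∀ q → ¬ (L q × U q)
    located  : ∀ {p q} → p ℚ.< q → L p ⊎ U q

open Real public

-- F n = ⌊ α n ⌋ for all n :  F 0 = 0 and, for n ≥ 1,  F n / n ≤ α < (F n + 1) / n.
IsFloorMul : Real → (ℕ → ℕ) → Set
IsFloorMul α F =
  (F 0 ≡ 0) ×
  (∀ n → ¬ U α ((+ F (suc n)) ℚ./ suc n) × U α ((+ suc (F (suc n))) ℚ./ suc n))

-- G n = ⌊ (1 - α) n ⌋ for all n :  G 0 = 0 and, for n ≥ 1,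
--   (n - G n - 1) / n < α ≤ (n - G n) / n.
IsFloorOneMinusMul : Real → (ℕ → ℕ) → Set
IsFloorOneMinusMul α G =
  (G 0 ≡ 0) ×
  (∀ n → L α (((+ suc n) ℤ.- (+ G (suc n)) ℤ.- (+ 1)) ℚ./ suc n)
       × ¬ L α (((+ suc n) ℤ.- (+ G (suc n))) ℚ./ suc n))

-- Finite rooted (unordered in spirit) trees with unbounded degree.

data Tree : Set where
  node : List Tree → Tree

mutual
  size : Tree → ℕ
  size (node ts) = suc (sizes ts)

  sizes : List Tree → ℕ
  sizes []       = 0
  sizes (t ∷ ts) = size t + sizes ts

-- Nodes of a tree (as addresses from the root).
data Pos : Tree → Set where
  here  : ∀ {ts} → Pos (node ts)
  there : ∀ {ts} (i : Fin (length ts)) → Pos (lookup ts i) → Pos (node ts)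

nca : ∀ {t} → Pos t → Pos t → Pos t
nca here          _             = here
nca (there i p)   here          = here
nca (there i p)   (there j q) with i Fin.≟ j
... | yes refl = there i (nca p q)
... | no  _    = here

-- T is a topological minor of V: injective f with f(NCA(u,v)) = NCA(f u, f v).
_≼_ : Tree → Tree → Set
T ≼ V = Σ (Pos T → Pos V) λ f →
          Injective _≡_ _≡_ f × (∀ u v → f (nca u v) ≡ nca (f u) (f v))

-- Possibly empty trees are Maybe Tree (nothing = empty tree).
_≼ᵐ_ : Tree → Maybe Tree → Set
T ≼ᵐ nothing = ⊥
T ≼ᵐ just V  = T ≼ V

-- The sequences a_N (fuel-based recursion; fuel N suffices since ⌊N/2⌋ < N).

seqAF : ℕ → ℕ → List ℕ
seqAF zero     _ = []
seqAF (suc f)  zero = []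
seqAF (suc f)  (suc N) = h ++ (suc N ∷ h)
  where h = seqAF f (suc N / 2)

seqA : ℕ → List ℕ
seqA N = seqAF N N

-- The trees U_n, parametrised by F n = ⌊α n⌋ and G n = ⌊(1-α) n⌋.
-- Fuel f ≥ n suffices since all recursive indices are < n (given the specs).

maybeToList : Maybe Tree → List Tree
maybeToList nothing  = []
maybeToList (just t) = t ∷ []

UF : (F G : ℕ → ℕ) → ℕ → ℕ → Maybe Tree
UF F G _       zero    = nothing
UF F G zero    (suc n) = nothing
UF F G (suc f) (suc n) = just (spine (seqA (G (suc n))))
  where
    opt : ℕ → List Tree
    opt m = maybeToList (UF F G f m)
    -- copies of U_{⌊m/j⌋} for j = 2, …, m  (for j > m these are empty)
    divs : ℕ → List Tree
    divs m = concatMap (λ k → opt (m / suc (suc k))) (upTo (m ∸ 1))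
    att : ℕ → List Tree
    att m = opt (m ∸ 1) ++ divs m
    lastAtt : List Tree
    lastAtt = opt (F (suc n)) ++ divs n     -- n = (suc n) - 1
    spine : List ℕ → Tree
    spine = foldr (λ m t → node (t ∷ att m)) (node lastAtt)

Utree : (F G : ℕ → ℕ) → ℕ → Maybe Tree
Utree F G n = UF F G n n

module Submission where

-- We prove the stronger statement that U_n contains every tree with at most
-- n nodes, by induction on n.  Let c = ⌊αn⌋ and follow the heavy path of T:
-- starting at the root, move to a child with more than c nodes while there is
-- one.  Record at each step the weight 1 + (sizes of the other children); the
-- weights sum to at most n − 1 − c ≤ ⌊(1−α)n⌋, so by the key property of the
-- sequences a_N they are dominated by a subsequence of the spine labels
-- a_{⌊(1−α)n⌋}.  Map the heavy path to the corresponding spine nodes; the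
-- light children at a spine node labelled a, and the children of the last
-- heavy-path node, are distributed greedily over the attached copies
-- U_{a−1}, U_{⌊a/j⌋} (resp. U_{⌊αn⌋}, U_{⌊(n−1)/j⌋}), which contain them by
-- induction.

open import Defs
open import Data.Nat using (ℕ)
open import Data.Rational using (½; 1ℚ)
open import Relation.Binary.PropositionalEquality using (_≡_)

open import Data.Fin as Fin using (Fin; zero; suc)
import Data.Fin.Properties as FinP
open import Data.Integer as ℤ using (+_; +≤+; +<+)
import Data.Integer.Properties as ℤP
open import Data.Integer.Solver using (module +-*-Solver)
open import Data.List using (List; []; _∷_; _++_; length; lookup; map; concatMap; upTo; applyUpTo; foldr)
import Data.List.Properties as ListP
open import Data.List.Relation.Unary.All as All using (All; []; _∷_)
import Data.List.Relation.Unary.All.Properties as AllP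
open import Data.List.Relation.Binary.Sublist.Heterogeneous using (Sublist; []; _∷_; _∷ʳ_; minimum)
import Data.List.Relation.Binary.Sublist.Heterogeneous.Properties as SublistP
open import Data.Maybe using (Maybe; just; nothing)
open import Data.Nat as ℕ using (zero; suc; _+_; _*_; _∸_; _/_; _%_; _≤_; _<_; z≤n; s≤s)
import Data.Nat.DivMod as DM
open import Data.Nat.ListAction using (sum)
import Data.Nat.ListAction.Properties as ΣP
import Data.Nat.Properties as ℕP
open import Algebra.Properties.CommutativeSemigroup ℕP.+-commutativeSemigroup using (x∙yz≈y∙xz)
open import Data.Product using (Σ; ∃; _×_; _,_; proj₁; proj₂)
open import Data.Rational as ℚ using (toℚᵘ)
import Data.Rational.Properties as ℚP
open import Data.Rational.Unnormalised as ℚᵘ using (mkℚᵘ; *<*; *≤*)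
import Data.Rational.Unnormalised.Properties as ℚᵘP
open import Function.Definitions using (Injective)
open import Relation.Nullary using (yes; no; contradiction)
open import Relation.Binary.PropositionalEquality using (_≢_; refl; sym; trans; cong; subst; subst₂)

toℚᵘ-/ : ∀ i d → toℚᵘ (i ℚ./ suc d) ℚᵘ.≃ mkℚᵘ i d
toℚᵘ-/ i d = ℚP.toℚᵘ-fromℚᵘ (mkℚᵘ i d)

/-<⇒ : ∀ i j d e → i ℚ./ suc d ℚ.< j ℚ./ suc e → i ℤ.* + suc e ℤ.< j ℤ.* + suc d
/-<⇒ i j d e p
  with ℚᵘP.<-respʳ-≃ (toℚᵘ-/ j e) (ℚᵘP.<-respˡ-≃ (toℚᵘ-/ i d) (ℚP.toℚᵘ-mono-< p))
... | *<* q = q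

/-<⇐ : ∀ i j d e → i ℤ.* + suc e ℤ.< j ℤ.* + suc d → i ℚ./ suc d ℚ.< j ℚ./ suc e
/-<⇐ i j d e q = ℚP.toℚᵘ-cancel-<
  (ℚᵘP.<-respʳ-≃ (ℚᵘP.≃-sym (toℚᵘ-/ j e)) (ℚᵘP.<-respˡ-≃ (ℚᵘP.≃-sym (toℚᵘ-/ i d)) (*<* q)))

/-≤⇐ : ∀ i j d e → i ℤ.* + suc e ℤ.≤ j ℤ.* + suc d → i ℚ./ suc d ℚ.≤ j ℚ./ suc e
/-≤⇐ i j d e q = ℚP.toℚᵘ-cancel-≤
  (ℚᵘP.≤-respʳ-≃ (ℚᵘP.≃-sym (toℚᵘ-/ j e)) (ℚᵘP.≤-respˡ-≃ (ℚᵘP.≃-sym (toℚᵘ-/ i d)) (*≤* q)))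

module _ (α : Real) where

  L-≤ : ∀ {p q} → L α q → p ℚ.≤ q → L α p
  L-≤ lq p≤q with L-open α lq
  ... | r , q<r , lr = L-down α (ℚP.≤-<-trans p≤q q<r) lr

  U-≤ : ∀ {p q} → U α p → p ℚ.≤ q → U α q
  U-≤ up p≤q with U-open α up
  ... | r , r<p , ur = U-up α (ℚP.<-≤-trans r<p p≤q) ur

  L<U : ∀ {p q} → L α p → U α q → p ℚ.< q
  L<U lp uq = ℚP.≰⇒> (λ q≤p → disjoint α _ (L-≤ lp q≤p , uq))

record Admissible (F G : ℕ → ℕ) : Set where
  field
    F-below      : ∀ n → F (suc n) ≤ n        -- α < 1
    G-below      : ∀ n → G (suc n) ≤ n        -- α > 0
    light-budget : ∀ n → n ∸ F (suc n) ≤ G (suc n)   -- n ≤ ⌊α(n+1)⌋ + ⌊(1-α)(n+1)⌋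

sub-sub-<⇒≤ : ∀ a b c → + a ℤ.- + b ℤ.- + 1 ℤ.< + c → a ≤ c + b
sub-sub-<⇒≤ a b c lt =
  ℕP.≤-pred (subst (a <_) (ℕP.+-suc c b) (ℤP.drop‿+<+ (subst (ℤ._< + (c + suc b)) cancel shifted)))
  where
    open +-*-Solver
    shifted : + a ℤ.- + b ℤ.- + 1 ℤ.+ (+ 1 ℤ.+ + b) ℤ.< + c ℤ.+ (+ 1 ℤ.+ + b)
    shifted = ℤP.+-monoˡ-< (+ 1 ℤ.+ + b) lt
    cancel : + a ℤ.- + b ℤ.- + 1 ℤ.+ (+ 1 ℤ.+ + b) ≡ + a
    cancel = solve 2 (λ x y → x :- y :- con (+ 1) :+ (con (+ 1) :+ y) := x) refl (+ a) (+ b)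

admissible : (α : Real) → L α ½ → U α 1ℚ → (F G : ℕ → ℕ) →
             IsFloorMul α F → IsFloorOneMinusMul α G → Admissible F G
admissible α ½<α α<1 F G (_ , F-spec) (_ , G-spec) = record
  { F-below = F-below ; G-below = G-below ; light-budget = light-budget }
  where
    -- if n < F (n+1) then 1 ≤ F(n+1)/(n+1), so F(n+1)/(n+1) would exceed α
    F-below : ∀ n → F (suc n) ≤ n
    F-below n with F (suc n) ℕP.≤? n
    ... | yes F≤n = F≤n
    ... | no F≰n = contradiction (U-≤ α α<1 1≤F/n) (proj₁ (F-spec n))
      where
        1≤F/n : 1ℚ ℚ.≤ + F (suc n) ℚ./ suc n
        1≤F/n = /-≤⇐ (+ 1) (+ F (suc n)) 0 n
          (subst₂ ℤ._≤_ (sym (ℤP.*-identityˡ _)) (sym (ℤP.*-identityʳ _)) (+≤+ (ℕP.≰⇒> F≰n)))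
    -- if n < G (n+1) then (n+1 − G(n+1))/(n+1) ≤ 0 < ½ would lie below α
    G-below : ∀ n → G (suc n) ≤ n
    G-below n with G (suc n) ℕP.≤? n
    ... | yes G≤n = G≤n
    ... | no G≰n = contradiction (L-down α below-½ ½<α) (proj₂ (G-spec n))
      where
        numerator≤0 : + suc n ℤ.- + G (suc n) ℤ.≤ + 0
        numerator≤0 = ℤP.i≤j⇒i-j≤0 (+≤+ (ℕP.≰⇒> G≰n))
        below-½ : (+ suc n ℤ.- + G (suc n)) ℚ./ suc n ℚ.< ½
        below-½ = /-<⇐ (+ suc n ℤ.- + G (suc n)) (+ 1) n 1
          (ℤP.≤-<-trans (ℤP.*-monoʳ-≤-nonNeg (+ 2) numerator≤0) (+<+ (s≤s z≤n)))
    -- (n+1 − G − 1)/(n+1) < α < (F + 1)/(n+1) forces n + 1 ≤ (F + 1) + G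
    light-budget : ∀ n → n ∸ F (suc n) ≤ G (suc n)
    light-budget n = ℕP.m≤n+o⇒m∸n≤o (suc n) (suc (F (suc n)))
      (sub-sub-<⇒≤ (suc n) (G (suc n)) (suc (F (suc n)))
        (ℤP.*-cancelʳ-<-nonNeg (+ suc n)
          (/-<⇒ (+ suc n ℤ.- + G (suc n) ℤ.- + 1) (+ suc (F (suc n))) n n
                (L<U α (proj₁ (G-spec n)) (proj₂ (F-spec n))))))

nca-same : ∀ {ts} (i : Fin (length ts)) (p q : Pos (lookup ts i)) →
           nca (there {ts} i p) (there i q) ≡ there i (nca p q)
nca-same i p q with i Fin.≟ i
... | yes refl = refl
... | no i≢i = contradiction refl i≢i

nca-apart : ∀ {ts} {i j : Fin (length ts)} (p : Pos (lookup ts i)) (q : Pos (lookup ts j)) →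
            i ≢ j → nca (there {ts} i p) (there j q) ≡ here
nca-apart {i = i} {j} p q i≢j with i Fin.≟ j
... | yes i≡j = contradiction i≡j i≢j
... | no _ = refl

there-index : ∀ {ts} {i j : Fin (length ts)} {p q} → there {ts} i p ≡ there j q → i ≡ j
there-index refl = refl

there-injective : ∀ {ts} {i : Fin (length ts)} {p q} → there {ts} i p ≡ there i q → p ≡ q
there-injective refl = refl

descend : ∀ {T vs} (i : Fin (length vs)) → T ≼ lookup vs i → T ≼ node vs
descend {vs = vs} i (f , f-inj , f-nca) =
  (λ p → there i (f p)) ,
  (λ e → f-inj (there-injective e)) ,
  (λ p q → trans (cong (there i) (f-nca p q)) (sym (nca-same {vs} i (f p) (f q))))

children : ∀ {ts vs} (σ : Fin (length ts) → Fin (length vs)) → Injective _≡_ _≡_ σ →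
           (∀ k → lookup ts k ≼ lookup vs (σ k)) → node ts ≼ node vs
children {ts} {vs} σ σ-inj emb = g , g-inj , g-nca
  where
    g : Pos (node ts) → Pos (node vs)
    g here = here
    g (there k p) = there (σ k) (proj₁ (emb k) p)

    g-inj : Injective _≡_ _≡_ g
    g-inj {here}      {here}      _ = refl
    g-inj {here}      {there _ _} ()
    g-inj {there _ _} {here}      ()
    g-inj {there k p} {there l q} e with σ-inj (there-index e)
    ... | refl = cong (there k) (proj₁ (proj₂ (emb k)) (there-injective e))

    g-nca : ∀ p q → g (nca p q) ≡ nca (g p) (g q)
    g-nca here q = refl
    g-nca (there k p) here = refl
    g-nca (there k p) (there l q) with k Fin.≟ l
    ... | yes refl = trans (cong (there (σ k)) (proj₂ (proj₂ (emb k)) p q))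
                           (sym (nca-same {vs} (σ k) _ _))
    ... | no k≢l = sym (nca-apart {vs} (proj₁ (emb k) p) (proj₁ (emb l) q) (λ e → k≢l (σ-inj e)))

data Select {A : Set} (x : A) : List A → List A → Set where
  first : ∀ {xs} → Select x (x ∷ xs) xs
  later : ∀ {y xs ys} → Select x xs ys → Select x (y ∷ xs) (y ∷ ys)

module _ {A : Set} {x : A} where

  position : ∀ {xs ys} → Select x xs ys → Fin (length xs)
  position first     = zero
  position (later s) = suc (position s)

  skip : ∀ {xs ys} → Select x xs ys → Fin (length ys) → Fin (length xs)
  skip first     k       = suc k
  skip (later s) zero    = zero
  skip (later s) (suc k) = suc (skip s k)

  lookup-position : ∀ {xs ys} (s : Select x xs ys) → lookup xs (position s) ≡ x
  lookup-position first     = refl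
  lookup-position (later s) = lookup-position s

  lookup-skip : ∀ {xs ys} (s : Select x xs ys) k → lookup xs (skip s k) ≡ lookup ys k
  lookup-skip first     k       = refl
  lookup-skip (later s) zero    = refl
  lookup-skip (later s) (suc k) = lookup-skip s k

  skip-injective : ∀ {xs ys} (s : Select x xs ys) → Injective _≡_ _≡_ (skip s)
  skip-injective first                     e = FinP.suc-injective e
  skip-injective (later s) {zero}  {zero}  e = refl
  skip-injective (later s) {suc k} {suc l} e = cong suc (skip-injective s (FinP.suc-injective e))

  skip≢position : ∀ {xs ys} (s : Select x xs ys) k → skip s k ≢ position s
  skip≢position (later s) (suc k) e = skip≢position s k (FinP.suc-injective e)

data Assign : List Tree → List Tree → Set where
  []    : ∀ {vs} → Assign [] vs
  place : ∀ {t ts v vs vs'} → Select v vs vs' → t ≼ v → Assign ts vs' → Assign (t ∷ ts) vs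

slot : ∀ {ts vs} → Assign ts vs → Fin (length ts) → Fin (length vs)
slot (place s _ a) zero    = position s
slot (place s _ a) (suc k) = skip s (slot a k)

slot-injective : ∀ {ts vs} (a : Assign ts vs) → Injective _≡_ _≡_ (slot a)
slot-injective (place s _ a) {zero}  {zero}  e = refl
slot-injective (place s _ a) {zero}  {suc l} e = contradiction (sym e) (skip≢position s _)
slot-injective (place s _ a) {suc k} {zero}  e = contradiction e (skip≢position s _)
slot-injective (place s _ a) {suc k} {suc l} e = cong suc (slot-injective a (skip-injective s e))

slot-minor : ∀ {ts vs} (a : Assign ts vs) k → lookup ts k ≼ lookup vs (slot a k)
slot-minor (place s t≼v a) zero    = subst (_ ≼_) (sym (lookup-position s)) t≼v
slot-minor (place s _ a)   (suc k) = subst (_ ≼_) (sym (lookup-skip s (slot a k))) (slot-minor a k)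

assign⇒≼ : ∀ {ts vs} → Assign ts vs → node ts ≼ node vs
assign⇒≼ a = children (slot a) (slot-injective a) (slot-minor a)

assign-insert : ∀ {t ts ts' v vs} → Select t ts ts' → t ≼ v → Assign ts' vs → Assign ts (v ∷ vs)
assign-insert first     t≼v a                = place first t≼v a
assign-insert (later s) t≼v (place s' u≼w a) = place (later s') u≼w (assign-insert s t≼v a)

all-select : ∀ {A : Set} {P : A → Set} {x xs ys} → Select x xs ys → All P xs → P x × All P ys
all-select first     (px ∷ pxs) = px , pxs
all-select (later s) (py ∷ pxs) with all-select s pxs
... | px , pys = px , py ∷ pys

sizes-select : ∀ {t ts ts'} → Select t ts ts' → sizes ts ≡ size t + sizes ts'
sizes-select first = refl
sizes-select {t} (later {y} {ys = ys} s) =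
  trans (cong (λ k → size y + k) (sizes-select s)) (x∙yz≈y∙xz (size y) (size t) (sizes ys))

size>0 : ∀ t → 0 < size t
size>0 (node _) = s≤s z≤n

size≤sizes : ∀ ts → All (λ u → size u ≤ sizes ts) ts
size≤sizes []       = []
size≤sizes (t ∷ ts) = ℕP.m≤m+n (size t) (sizes ts) ∷
                      All.map (λ u≤ → ℕP.≤-trans u≤ (ℕP.m≤n+m (sizes ts) (size t))) (size≤sizes ts)

data Crossing (h : ℕ) : List ℕ → Set where
  below : ∀ {ws} → sum ws ≤ h → Crossing h ws
  split : ∀ pre w post → sum pre ≤ h → h < sum pre + w → Crossing h (pre ++ w ∷ post)

crossing-∷ : ∀ w {h ws} → Crossing h ws → Crossing (w + h) (w ∷ ws)
crossing-∷ w (below s) = below (ℕP.+-monoʳ-≤ w s)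
crossing-∷ w {h} (split pre x post s h<s) =
  split (w ∷ pre) x post (ℕP.+-monoʳ-≤ w s)
        (subst (w + h <_) (sym (ℕP.+-assoc w (sum pre) x)) (ℕP.+-monoʳ-< w h<s))

crossing : ∀ h ws → Crossing h ws
crossing h []       = below z≤n
crossing h (w ∷ ws) with h ℕP.<? w
... | yes h<w = split [] w ws z≤n h<w
... | no  h≮w = subst (λ h → Crossing h (w ∷ ws)) (ℕP.m+[n∸m]≡n (ℕP.≮⇒≥ h≮w))
                      (crossing-∷ w (crossing (h ∸ w) ws))

half-cover : ∀ m → m ≤ m / 2 + suc (m / 2)
half-cover m = begin
  m                   ≡⟨ DM.m≡m%n+[m/n]*n m 2 ⟩
  m % 2 + h * 2       ≤⟨ ℕP.+-monoˡ-≤ (h * 2) (ℕP.≤-pred (DM.m%n<n m 2)) ⟩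
  suc (h * 2)         ≡⟨ cong suc (ℕP.*-comm h 2) ⟩
  suc (h + (h + 0))   ≡⟨ cong (λ k → suc (h + k)) (ℕP.+-identityʳ h) ⟩
  suc (h + h)         ≡⟨ sym (ℕP.+-suc h h) ⟩
  h + suc h           ∎
  where
    open ℕP.≤-Reasoning
    h : ℕ
    h = m / 2

half-below : ∀ N → suc N / 2 ≤ N
half-below N = ℕP.≤-pred (DM.m/n<m (suc N) 2 (s≤s (s≤s z≤n)))

-- Split the list where its
-- running sum crosses h = ⌊N/2⌋: the prefix and the suffix after the crossing
-- entry both have total ≤ h, so they fit into the two copies of a_h, and the
-- crossing entry itself is at most N.  (Any fuel f ≥ N computes a_N.)
a-dominates : ∀ f N ws → N ≤ f → All (0 <_) ws → sum ws ≤ N → Sublist _≤_ ws (seqAF f N)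
a-dominates f       zero    []       _   _             _      = minimum _
a-dominates f       zero    (w ∷ ws) _   (w>0 ∷ _)     ws≤0   =
  contradiction (ℕP.≤-trans (ℕP.m≤m+n w (sum ws)) ws≤0) (ℕP.<⇒≱ w>0)
a-dominates zero    (suc N) ws       ()
a-dominates (suc f) (suc N) ws       N<f positive ws≤N =
  from-crossing (crossing h ws) positive ws≤N
  where
    h : ℕ
    h = suc N / 2
    h≤f : h ≤ f
    h≤f = ℕP.≤-trans (half-below N) (ℕP.≤-pred N<f)

    from-crossing : ∀ {ws} → Crossing h ws → All (0 <_) ws → sum ws ≤ suc N →
                    Sublist _≤_ ws (seqAF f h ++ suc N ∷ seqAF f h)
    from-crossing (below ws≤h) positive _ = SublistP.++ʳ _ (a-dominates f h _ h≤f positive ws≤h)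
    from-crossing (split pre w post pre≤h h<pre+w) positive ws≤N =
      SublistP.++⁺ (a-dominates f h pre h≤f (AllP.++⁻ˡ pre positive) pre≤h)
                   (w≤N ∷ a-dominates f h post h≤f (All.tail (AllP.++⁻ʳ pre positive)) post≤h)
      where
        total : sum pre + (w + sum post) ≤ suc N
        total = subst (_≤ suc N) (ΣP.sum-++ pre (w ∷ post)) ws≤N
        w≤N : w ≤ suc N
        w≤N = ℕP.≤-trans (ℕP.≤-trans (ℕP.m≤m+n w (sum post)) (ℕP.m≤n+m _ (sum pre))) total
        post≤h : sum post ≤ h
        post≤h = ℕP.+-cancelˡ-≤ (suc h) (sum post) h (begin
          suc h + sum post          ≤⟨ ℕP.+-monoˡ-≤ (sum post) h<pre+w ⟩
          sum pre + w + sum post    ≡⟨ ℕP.+-assoc (sum pre) w (sum post) ⟩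
          sum pre + (w + sum post)  ≤⟨ total ⟩
          suc N                     ≤⟨ half-cover (suc N) ⟩
          h + suc h                 ≡⟨ ℕP.+-comm h (suc h) ⟩
          suc h + h                 ∎)
          where open ℕP.≤-Reasoning

a-bounded : ∀ f N → All (_≤ N) (seqAF f N)
a-bounded zero    N       = []
a-bounded (suc f) zero    = []
a-bounded (suc f) (suc N) = AllP.++⁺ halves (ℕP.≤-refl ∷ halves)
  where
    halves : All (_≤ suc N) (seqAF f (suc N / 2))
    halves = All.map (λ x≤h → ℕP.≤-trans x≤h (DM.m/n≤m (suc N) 2)) (a-bounded f (suc N / 2))

atLeast : ℕ → List Tree → ℕ
atLeast x []       = 0
atLeast x (u ∷ us) with x ℕP.≤? size u
... | yes _ = suc (atLeast x us)
... | no  _ = atLeast x us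

atLeast-bound : ∀ x ts → x * atLeast x ts ≤ sizes ts
atLeast-bound x []       = ℕP.≤-reflexive (ℕP.*-zeroʳ x)
atLeast-bound x (u ∷ us) with x ℕP.≤? size u
... | yes x≤u = subst (_≤ size u + sizes us) (sym (ℕP.*-suc x (atLeast x us)))
                      (ℕP.+-mono-≤ x≤u (atLeast-bound x us))
... | no  _   = ℕP.≤-trans (atLeast-bound x us) (ℕP.m≤n+m (sizes us) (size u))

atLeast-select : ∀ {x t ts ts'} → Select t ts ts' → x ≤ size t → atLeast x ts ≡ suc (atLeast x ts')
atLeast-select {x} {t} first x≤t with x ℕP.≤? size t
... | yes _   = refl
... | no  x≰t = contradiction x≤t x≰t
atLeast-select {x} (later {y} s) x≤t with x ℕP.≤? size y
... | yes _ = cong suc (atLeast-select s x≤t)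
... | no  _ = atLeast-select s x≤t

selected-counted : ∀ {t ts ts'} → Select t ts ts' → 0 < atLeast (size t) ts
selected-counted s = subst (0 <_) (sym (atLeast-select s ℕP.≤-refl)) (s≤s z≤n)

largest : ∀ t ts → Σ Tree λ m → Σ (List Tree) λ ts' →
          Select m (t ∷ ts) ts' × All (λ u → size u ≤ size m) (t ∷ ts)
largest t []       = t , [] , first , ℕP.≤-refl ∷ []
largest t (u ∷ us) with largest u us
... | m , ts' , s , below-m with size t ℕP.≤? size m
...   | yes t≤m = m , t ∷ ts' , later s , t≤m ∷ below-m
...   | no  t≰m = t , u ∷ us , first ,
                  ℕP.≤-refl ∷ All.map (λ u≤m → ℕP.≤-trans u≤m (ℕP.<⇒≤ (ℕP.≰⇒> t≰m))) below-m

capacity : List ℕ → ℕ → ℕ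
capacity []       _       = 0
capacity (b ∷ bs) zero    = b
capacity (b ∷ bs) (suc i) = capacity bs i

capacity-applyUpTo : ∀ (g h : ℕ → ℕ) r i → i < r → capacity (map g (applyUpTo h r)) i ≡ g (h i)
capacity-applyUpTo g h (suc r) zero    _         = refl
capacity-applyUpTo g h (suc r) (suc i) (s≤s i<r) = capacity-applyUpTo g (λ k → h (suc k)) r i i<r

-- Hall-type condition for filling slots of capacities bs with the trees ts:
-- if k trees have size ≥ size u, then the first k slots can each hold u.
Roomy : List Tree → List ℕ → Set
Roomy ts bs = All (λ u → ∀ i → i < atLeast (size u) ts → size u ≤ capacity bs i) ts

-- Greedy filling, for a family W of trees where W b is universal for trees
-- with at most b nodes (b ≤ B): each slot in turn receives a largest
-- remaining tree.
module Filling (W : ℕ → Maybe Tree) (B : ℕ)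
               (universal : ∀ b → b ≤ B → ∀ t → size t ≤ b → t ≼ᵐ W b) where

  slots : List ℕ → List Tree
  slots = concatMap (λ b → maybeToList (W b))

  fill-first : ∀ {t ts ts' vs} (mv : Maybe Tree) → t ≼ᵐ mv → Select t ts ts' →
               Assign ts' vs → Assign ts (maybeToList mv ++ vs)
  fill-first (just v) t≼v s a = assign-insert s t≼v a
  fill-first nothing  ()

  greedy : ∀ bs ts → All (_≤ B) bs → Roomy ts bs → Assign ts (slots bs)
  greedy bs       []         _            _             = []
  greedy []       (t ∷ ts)   _            (room-t ∷ _)  =
    contradiction (room-t 0 (selected-counted {t} {t ∷ ts} first)) (ℕP.<⇒≱ (size>0 t))
  greedy (b ∷ bs) (t₀ ∷ ts₀) (b≤B ∷ bs≤B) room with largest t₀ ts₀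
  ... | t , ts' , s , maximal with all-select s room | all-select s maximal
  ...   | room-t , room-ts' | _ , maximal-ts' =
    fill-first (W b) (universal b b≤B t (room-t 0 (selected-counted s))) s
               (greedy bs ts' bs≤B (All.zipWith (λ (r , m) → shift r m) (room-ts' , maximal-ts')))
    where
      -- removing t, which is at least as large as every u, shifts u's slots by one
      shift : ∀ {u} → (∀ i → i < atLeast (size u) (t₀ ∷ ts₀) → size u ≤ capacity (b ∷ bs) i) →
              size u ≤ size t → ∀ i → i < atLeast (size u) ts' → size u ≤ capacity bs i
      shift room-u u≤t i i<k = room-u (suc i) (subst (suc i <_) (sym (atLeast-select s u≤t)) (s≤s i<k))

  -- Trees of size ≤ c and total size ≤ M fit into the slots
  -- W c, W ⌊M/2⌋, W ⌊M/3⌋, …, W ⌊M/M⌋: if k trees have size ≥ s then k·s ≤ M,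
  -- so the slots W ⌊M/2⌋, …, W ⌊M/k⌋ (and W c) can hold them.
  fill-divisor-slots : ∀ c M ts → All (λ u → size u ≤ c) ts → sizes ts ≤ M → c ≤ B → M ≤ suc B →
    Assign ts (maybeToList (W c) ++ concatMap (λ k → maybeToList (W (M / suc (suc k)))) (upTo (M ∸ 1)))
  fill-divisor-slots c M ts below-c total c≤B M≤B+1 =
    subst (Assign ts) (cong (maybeToList (W c) ++_) (ListP.concatMap-map _ share (upTo (M ∸ 1))))
      (greedy (c ∷ map share (upTo (M ∸ 1))) ts
              (c≤B ∷ AllP.map⁺ (All.universal share≤B (upTo (M ∸ 1))))
              (All.map roomy below-c))
    where
      share : ℕ → ℕ
      share k = M / suc (suc k)

      share≤B : ∀ k → share k ≤ B
      share≤B k = ℕP.≤-trans (DM./-monoʳ-≤ M (s≤s (s≤s z≤n)))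
                            (ℕP.≤-trans (DM./-monoˡ-≤ 2 M≤B+1) (half-below B))

      roomy : ∀ {u} → size u ≤ c → ∀ i → i < atLeast (size u) ts →
              size u ≤ capacity (c ∷ map share (upTo (M ∸ 1))) i
      roomy u≤c zero    _   = u≤c
      roomy {u} u≤c (suc j) j<k =
        subst (size u ≤_) (sym (capacity-applyUpTo share (λ k → k) (M ∸ 1) j j<M-1)) u≤share
        where
          multiple≤M : size u * suc (suc j) ≤ M
          multiple≤M = ℕP.≤-trans (ℕP.*-monoʳ-≤ (size u) j<k)
                                  (ℕP.≤-trans (atLeast-bound (size u) ts) total)
          j<M-1 : j < M ∸ 1
          j<M-1 = ℕP.∸-monoˡ-≤ 1
            (ℕP.≤-trans (ℕP.m≤n*m (suc (suc j)) (size u) {{ℕ.>-nonZero (size>0 u)}}) multiple≤M)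
          u≤share : size u ≤ share j
          u≤share = subst (_≤ share j) (DM.m*n/n≡m (size u) (suc (suc j)))
                          (DM./-monoˡ-≤ (suc (suc j)) multiple≤M)

data HeavyPath (c : ℕ) : Tree → List ℕ → Set where
  end  : ∀ {ts} → All (λ u → size u ≤ c) ts → HeavyPath c (node ts) []
  step : ∀ {t ts ts' ws} → Select t ts ts' → c < size t → HeavyPath c t ws →
         HeavyPath c (node ts) (suc (sizes ts') ∷ ws)

data HeavyChoice (c : ℕ) (ts : List Tree) : Set where
  light : All (λ u → size u ≤ c) ts → HeavyChoice c ts
  heavy : ∀ {t ts' ws} → Select t ts ts' → c < size t → HeavyPath c t ws → HeavyChoice c ts

mutual
  heavy-path : ∀ c T → ∃ (HeavyPath c T)
  heavy-path c (node ts) with heavy-choice c ts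
  ... | light all-light = [] , end all-light
  ... | heavy s c<t hp  = _ , step s c<t hp

  heavy-choice : ∀ c ts → HeavyChoice c ts
  heavy-choice c []       = light []
  heavy-choice c (u ∷ us) with size u ℕP.≤? c
  ... | no  u≰c = heavy first (ℕP.≰⇒> u≰c) (proj₂ (heavy-path c u))
  ... | yes u≤c with heavy-choice c us
  ...   | light all-light = light (u≤c ∷ all-light)
  ...   | heavy s c<t hp  = heavy (later s) c<t hp

heavy-path-positive : ∀ {c T ws} → HeavyPath c T ws → All (0 <_) ws
heavy-path-positive (end _)       = []
heavy-path-positive (step _ _ hp) = s≤s z≤n ∷ heavy-path-positive hp

heavy-path-weight : ∀ {c T ws} → HeavyPath c T ws → sum ws ≤ size T ∸ suc c
heavy-path-weight (end _) = z≤n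
heavy-path-weight {c} (step {t} {ts} {ts'} {ws} s c<t hp) = begin
  suc (sizes ts') + sum ws                ≤⟨ ℕP.+-monoʳ-≤ (suc (sizes ts')) (heavy-path-weight hp) ⟩
  suc (sizes ts') + (size t ∸ suc c)      ≡⟨ sym (ℕP.+-∸-assoc (suc (sizes ts')) c<t) ⟩
  (suc (sizes ts') + size t) ∸ suc c      ≡⟨ cong (λ k → suc k ∸ suc c) (ℕP.+-comm (sizes ts') (size t)) ⟩
  suc (size t + sizes ts') ∸ suc c        ≡⟨ cong (λ k → suc k ∸ suc c) (sym (sizes-select s)) ⟩
  size (node ts) ∸ suc c                  ∎
  where open ℕP.≤-Reasoning

module Universality (F G : ℕ → ℕ) (adm : Admissible F G) where
  open Admissible adm

  optional : ℕ → ℕ → List Tree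
  optional f m = maybeToList (UF F G f m)

  divisors : ℕ → ℕ → List Tree
  divisors f m = concatMap (λ k → optional f (m / suc (suc k))) (upTo (m ∸ 1))

  attached : ℕ → ℕ → List Tree
  attached f m = optional f (m ∸ 1) ++ divisors f m

  spine : ℕ → ℕ → List ℕ → Tree
  spine f n = foldr (λ m S → node (S ∷ attached f m))
                    (node (optional f (F (suc n)) ++ divisors f n))

  module _ (f n : ℕ) (n≤f : n ≤ f) (universal : ∀ m → m ≤ f → ∀ T → size T ≤ m → T ≼ᵐ UF F G f m) where
    open Filling (UF F G f) f universal

    along-spine : ∀ {T ws ms} → HeavyPath (F (suc n)) T ws → Sublist _≤_ ws ms → All (_≤ suc n) ms →
                  size T ≤ suc n → T ≼ spine f n ms
    along-spine {node ts} (end all-light) [] [] T≤ =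
      assign⇒≼ (fill-divisor-slots (F (suc n)) n ts all-light (ℕP.≤-pred T≤)
                                   (ℕP.≤-trans (F-below n) n≤f) (ℕP.≤-trans n≤f (ℕP.n≤1+n f)))
    along-spine hp (_ ∷ʳ fits) (_ ∷ ms≤) T≤ = descend zero (along-spine hp fits ms≤ T≤)
    along-spine {ms = m ∷ _} (step {t} {ts} {ts'} s _ hp) (w≤m ∷ fits) (m≤ ∷ ms≤) T≤ =
      assign⇒≼ (assign-insert s (along-spine hp fits ms≤ t≤)
                 (fill-divisor-slots (m ∸ 1) m ts' light-children others≤m
                                     (ℕP.∸-monoˡ-≤ 1 m≤f+1) m≤f+1))
      where
        m≤f+1 : m ≤ suc f
        m≤f+1 = ℕP.≤-trans m≤ (s≤s n≤f)
        others≤m : sizes ts' ≤ m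
        others≤m = ℕP.≤-trans (ℕP.n≤1+n (sizes ts')) w≤m
        light-children : All (λ u → size u ≤ m ∸ 1) ts'
        light-children = All.map (λ u≤ → ℕP.≤-trans u≤ (ℕP.∸-monoˡ-≤ 1 w≤m)) (size≤sizes ts')
        t≤ : size t ≤ suc n
        t≤ = ℕP.≤-trans (ℕP.≤-trans (ℕP.m≤m+n (size t) (sizes ts'))
                                    (ℕP.≤-reflexive (sym (sizes-select s))))
                        (ℕP.≤-trans (ℕP.n≤1+n (sizes ts)) T≤)

  -- The induction, on the fuel f (any fuel f ≥ n computes U_n): the weights
  -- of the heavy path total at most G(n+1), so the spine labels a_{G(n+1)}
  -- dominate them, and every label is at most n + 1.
  universal : ∀ f n → n ≤ f → ∀ T → size T ≤ n → T ≼ᵐ UF F G f n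
  universal zero    zero    _   (node _) ()
  universal zero    (suc n) ()
  universal (suc f) zero    _   (node _) ()
  universal (suc f) (suc n) n<f T        T≤ with heavy-path (F (suc n)) T
  ... | ws , hp = along-spine f n n≤f (λ m m≤f → universal f m m≤f) hp
                    (a-dominates (G (suc n)) (G (suc n)) ws ℕP.≤-refl (heavy-path-positive hp) weight≤G)
                    (All.map (λ a≤G → ℕP.≤-trans a≤G (ℕP.≤-trans (G-below n) (ℕP.n≤1+n n)))
                             (a-bounded (G (suc n)) (G (suc n))))
                    T≤
    where
      n≤f : n ≤ f
      n≤f = ℕP.≤-pred n<f
      weight≤G : sum ws ≤ G (suc n)
      weight≤G = ℕP.≤-trans (heavy-path-weight hp)
                            (ℕP.≤-trans (ℕP.∸-monoˡ-≤ (suc (F (suc n))) T≤) (light-budget n))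

lemma3 : (α : Real) → L α ½ → U α 1ℚ →
         (F G : ℕ → ℕ) → IsFloorMul α F → IsFloorOneMinusMul α G →
         (n : ℕ) (T : Tree) → size T ≡ n → T ≼ᵐ Utree F G n
lemma3 α ½<α α<1 F G F-floor G-floor n T size≡n =
  Universality.universal F G (admissible α ½<α α<1 F G F-floor G-floor) n n ℕP.≤-refl T (ℕP.≤-reflexive size≡n)
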